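{- Let $k\geq 1$, $n\geq 1$, $m\geq 1$. Any $n\times m$ $k$TDS matrix that has an all-$0$ column has at least $kn$ entries equal to $1$.
   Context: For an $n\times m$ $(0,1)$-matrix $M=(m_{ij})$ (rows indexed by $i$, columns by $j$), define $\kappa(i,j)=\sum_{z} m_{iz}+\sum_{z} m_{zj}-2m_{ij}$, i.e. the $i$-th row sum plus the $j$-th column sum minus $2m_{ij}$. $M$ is a $k$TDS matrix if $\kappa(i,j)\geq k$ for all $i$ and $j$. (These correspond to $k$-tuple total dominating sets of the rook's graph $K_n\Box K_m$, the set being the positions of the ones.) -}

module Defs where

open import Data.Nat using (ℕ; zero; suc; _+_; _∸_; _≤_)
open import Data.Fin using (Fin; zero; suc)
open import Data.Bool using (Bool; true; false)
open import Data.Product using (∃)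

-- An n × m (0,1)-matrix: entry (i , j) is true iff m_ij = 1.
Matrix01 : ℕ → ℕ → Set
Matrix01 n m = Fin n → Fin m → Bool

val : Bool → ℕ
val true  = 1
val false = 0

sumFin : (n : ℕ) → (Fin n → ℕ) → ℕ
sumFin zero    f = 0
sumFin (suc n) f = f zero + sumFin n (λ z → f (suc z))

rowSum : ∀ {n m} → Matrix01 n m → Fin n → ℕ
rowSum {m = m} M i = sumFin m (λ z → val (M i z))

colSum : ∀ {n m} → Matrix01 n m → Fin m → ℕ
colSum {n = n} M j = sumFin n (λ z → val (M z j))

-- κ(i,j) = row sum + column sum − 2 m_ij  (never truncated: m_ij is counted in both sums)
κ : ∀ {n m} → Matrix01 n m → Fin n → Fin m → ℕ
κ M i j = (rowSum M i + colSum M j) ∸ (val (M i j) + val (M i j))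

IsKTDS : ∀ {n m} → ℕ → Matrix01 n m → Set
IsKTDS k M = ∀ i j → k ≤ κ M i j

ones : ∀ {n m} → Matrix01 n m → ℕ
ones {n = n} M = sumFin n (λ i → rowSum M i)

HasZeroColumn : ∀ {n m} → Matrix01 n m → Set
HasZeroColumn {n = n} {m = m} M = ∃ λ (j : Fin m) → ∀ (i : Fin n) → M i j ≡ false
  where open import Relation.Binary.PropositionalEquality using (_≡_)

module Submission where

open import Defs
open import Data.Nat using (ℕ; zero; suc; _≤_; _*_; _+_; z≤n)
open import Data.Nat.Properties using (+-mono-≤; +-identityʳ; *-comm)
open import Data.Fin using (Fin; zero; suc)
open import Data.Bool using (false)
open import Data.Product using (_,_)
open import Relation.Binary.PropositionalEquality using (_≡_; refl; cong; subst)

-- On an all-0 column j the column sum vanishes and the entry m_ij is 0, so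
-- κ(i,j) is just the i-th row sum; hence every row carries at least k ones.

sumFin-zero : ∀ n (f : Fin n → ℕ) → (∀ i → f i ≡ 0) → sumFin n f ≡ 0
sumFin-zero zero    f f≡0 = refl
sumFin-zero (suc n) f f≡0 rewrite f≡0 zero = sumFin-zero n (λ z → f (suc z)) (λ i → f≡0 (suc i))

sumFin-lower-bound : ∀ k n (f : Fin n → ℕ) → (∀ i → k ≤ f i) → n * k ≤ sumFin n f
sumFin-lower-bound k zero    f k≤f = z≤n
sumFin-lower-bound k (suc n) f k≤f =
  +-mono-≤ (k≤f zero) (sumFin-lower-bound k n (λ z → f (suc z)) (λ i → k≤f (suc i)))

colSum-zeroColumn : ∀ {n m} (M : Matrix01 n m) j → (∀ i → M i j ≡ false) → colSum M j ≡ 0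
colSum-zeroColumn {n} M j zero-col = sumFin-zero n (λ z → val (M z j)) (λ z → cong val (zero-col z))

κ-zeroColumn : ∀ {n m} (M : Matrix01 n m) j → (∀ i → M i j ≡ false) → ∀ i → κ M i j ≡ rowSum M i
κ-zeroColumn M j zero-col i
  rewrite zero-col i | colSum-zeroColumn M j zero-col = +-identityʳ (rowSum M i)

ones-lower-bound : ∀ k {n m} (M : Matrix01 n m) → (∀ i → k ≤ rowSum M i) → n * k ≤ ones M
ones-lower-bound k {n} M = sumFin-lower-bound k n (rowSum M)

lemma7 : (k n m : ℕ) → 1 ≤ k → 1 ≤ n → 1 ≤ m →
         (M : Matrix01 n m) → IsKTDS k M → HasZeroColumn M →
         k * n ≤ ones M
lemma7 k n m _ _ _ M kTDS (j , zero-col) =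
  subst (_≤ ones M) (*-comm n k) (ones-lower-bound k M k≤rowSum)
  where
  k≤rowSum : ∀ i → k ≤ rowSum M i
  k≤rowSum i = subst (k ≤_) (κ-zeroColumn M j zero-col i) (kTDS i j)
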